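{- Let $n\ge1$. For $r\ge 0$ let $N_r$ be the number of $w\in C_n$ with $cd(w)=r$, and $A_r$ the number of $w\in S_n$ with exactly $r$ descents. Then $N_{r+1}=2^nA_r$ for all $r\ge0$.
   Context: $C_n$ is the group of signed permutations of $\{1,\dots,n\}$. Order the symbols $1<2<\dots<n<-n<\dots<-1$. For $w\in C_n$, $cd(w)$ is the number of $i\in\{1,\dots,n-1\}$ with $w(i)>w(i+1)$ in this order, plus $1$ if $w(n)<0$, plus $1$ if $w(1)>0$. A descent of $w\in S_n$ is an $i\in\{1,\dots,n-1\}$ with $w(i)>w(i+1)$. -}

module Defs where

open import Data.Nat using (ℕ; zero; suc; _+_; _*_; _∸_; _<ᵇ_)
open import Data.Bool using (Bool; true; false; if_then_else_)
open import Data.Fin using (Fin; toℕ)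
open import Data.Fin.Properties using (_≟_)
open import Data.Product using (_×_; _,_; proj₁; proj₂)
open import Data.List using (List; []; _∷_; map; length; filter; allFin; concatMap; filterᵇ)
open import Data.Vec using (Vec; []; _∷_; toList)
import Data.List.Relation.Unary.Unique.DecPropositional as UDP
open import Relation.Nullary.Decidable using (⌊_⌋)
open import Data.Nat using (_≡ᵇ_)

allVecs : ∀ {A : Set} → List A → (k : ℕ) → List (Vec A k)
allVecs xs zero = [] ∷ []
allVecs xs (suc k) = concatMap (λ x → map (x ∷_) (allVecs xs k)) xs

-- S_n: permutations of {1..n} in one-line notation (0-based: Fin n),
-- i.e. length-n words over Fin n with pairwise distinct entries
Sn : (n : ℕ) → List (Vec (Fin n) n)
Sn n = filter (λ v → unique? (toList v)) (allVecs (allFin n) n)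
  where open UDP (_≟_ {n}) using (unique?)

-- signed letters: (true , i) is the positive symbol i+1, (false , i) is -(i+1)
Signed : ℕ → Set
Signed n = Bool × Fin n

zipV : ∀ {A B : Set} {k} → Vec A k → Vec B k → Vec (A × B) k
zipV [] [] = []
zipV (a ∷ as) (b ∷ bs) = (a , b) ∷ zipV as bs

Cn : (n : ℕ) → List (Vec (Signed n) n)
Cn n = concatMap (λ s → map (zipV s) (Sn n)) (allVecs (true ∷ false ∷ []) n)

-- rank in the order 1 < 2 < … < n < -n < … < -1
rank : ∀ {n} → Signed n → ℕ
rank {n} (true , i) = toℕ i
rank {n} (false , i) = (n + n) ∸ suc (toℕ i)

descentsBy : ∀ {A : Set} → (A → ℕ) → List A → ℕ
descentsBy key [] = 0
descentsBy key (x ∷ []) = 0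
descentsBy key (x ∷ y ∷ xs) =
  (if key y <ᵇ key x then 1 else 0) + descentsBy key (y ∷ xs)

des : ∀ {n} → Vec (Fin n) n → ℕ
des v = descentsBy toℕ (toList v)

lastNeg : ∀ {n k} → Vec (Signed n) k → ℕ
lastNeg [] = 0
lastNeg ((true , _) ∷ []) = 0
lastNeg ((false , _) ∷ []) = 1
lastNeg (_ ∷ y ∷ ys) = lastNeg (y ∷ ys)

firstPos : ∀ {n k} → Vec (Signed n) k → ℕ
firstPos [] = 0
firstPos ((true , _) ∷ _) = 1
firstPos ((false , _) ∷ _) = 0

cd : ∀ {n} → Vec (Signed n) n → ℕ
cd w = descentsBy rank (toList w) + lastNeg w + firstPos w

N : (n r : ℕ) → ℕ
N n r = length (filterᵇ (λ w → cd w ≡ᵇ r) (Cn n))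

A : (n r : ℕ) → ℕ
A n r = length (filterᵇ (λ w → des w ≡ᵇ r) (Sn n))

{-# OPTIONS --safe #-}
-- Let desℤ w count the descents of a signed permutation w in the usual order of ℤ. The order
-- 1 < … < n < -n < … < -1 of cd agrees with it on letters of equal sign and is reversed on
-- letters of opposite sign, so at each i, [w(i) > w(i+1) in cd's order] + [w(i) > 0] =
-- [w(i) > w(i+1) in ℤ] + [w(i+1) > 0]. Summing, the boundary terms of cd telescope and
-- cd w = 1 + desℤ w. Next, w amounts to a permutation σ together with a sign t(x) for every
-- value x. For fixed t the n letters ±x are totally ordered in ℤ, and replacing each by its
-- position in that order turns desℤ w into des of a permutation, which runs through S_n as σ
-- does. So each of the 2^n choices of t contributes A_r.
module Submission where

open import Defs
open import Data.Bool using (Bool; true; false; T; if_then_else_)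
open import Data.Bool.Properties using (T-≡)
open import Data.Empty using (⊥-elim)
open import Data.Fin using (Fin; toℕ; fromℕ<; punchOut)
open import Data.Fin.Properties using (_≟_; any?; toℕ<n; toℕ-injective; toℕ-fromℕ<; punchOut-injective; injective⇒≤)
open import Data.List as List using (List; []; _∷_; _++_; length; filterᵇ; allFin; concatMap; cartesianProductWith)
open import Data.List.Properties using (length-++; length-map; length-tabulate; filter-++; filter-≐; filter-notAll)
open import Data.List.Membership.Propositional using (_∈_)
open import Data.List.Membership.Propositional.Properties using (∈-allFin; ∈-map⁺; ∈-map⁻; ∈-filter⁺; ∈-filter⁻; ∈-cartesianProductWith⁺; ∈-cartesianProductWith⁻)
open import Data.List.Membership.Propositional.Properties.WithK using (unique∧set⇒bag)
open import Data.List.Relation.Binary.BagAndSetEquality using (∼bag⇒↭; set; _∼[_]_)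
open import Data.List.Relation.Binary.Permutation.Propositional using (_↭_)
open import Data.List.Relation.Binary.Permutation.Propositional.Properties using (↭-length; filter-↭)
open import Data.List.Relation.Unary.Any using (here; there)
import Data.List.Relation.Unary.Any as Any
open import Data.List.Relation.Unary.AllPairs using ([]; _∷_)
import Data.List.Relation.Unary.All as All
open import Data.List.Relation.Binary.Disjoint.Propositional using (Disjoint)
open import Data.List.Relation.Unary.Unique.Propositional using (Unique)
import Data.List.Relation.Unary.Unique.Propositional.Properties as Unique
import Data.List.Relation.Unary.Unique.DecPropositional as DecUnique
open import Data.Nat using (ℕ; zero; suc; _+_; _*_; _^_; _∸_; _≤_; _<_; _<ᵇ_; _≡ᵇ_; z≤n; s≤s; z<s)
open import Data.Nat.Properties using (<-≤-trans; <-trans; <⇒≤; <⇒≢; ≮⇒≥; _<?_; <-cmp; n≮n; m≤n⇒m≤1+n; m<n⇒m<1+n; m≤m+n; ∸-monoʳ-<; +-assoc; +-comm; +-identityʳ; +-suc; +-∸-assoc; +-cancelˡ-≡; ∸-cancelˡ-≡; suc-injective; <⇒<ᵇ; <ᵇ⇒<)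
open import Data.Product using (_×_; _,_; proj₁; proj₂; ∃)
open import Data.Unit using (tt)
open import Data.Vec as Vec using (Vec; []; _∷_; lookup; toList; tabulate)
open import Data.Vec.Properties using (∷-injective; ∷-injectiveˡ; ∷-injectiveʳ; toList-map; lookup-map; map-∘; map-cong; map-id; lookup∘tabulate; tabulate∘lookup; tabulate-cong)
import Data.Vec.Relation.Unary.All.Properties as VecAll
open import Data.Vec.Relation.Unary.AllPairs using ([]; _∷_)
import Data.Vec.Relation.Unary.Unique.Propositional as VecUnique
import Data.Vec.Relation.Unary.Unique.Propositional.Properties as VecUnique
open import Function using (_∘_)
open import Function.Bundles using (Equivalence; mk⇔)
open import Function.Definitions using (Injective)
open import Relation.Binary using (tri<; tri≈; tri>)
open import Relation.Binary.PropositionalEquality using (_≡_; _≢_; refl; sym; trans; cong; cong₂; subst; module ≡-Reasoning)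
open import Relation.Nullary using (¬_; yes; no; contradiction)
open import Relation.Nullary.Decidable using (T?)

open ≡-Reasoning

bit : Bool → ℕ
bit b = if b then 1 else 0

<⇒<ᵇ≡true : ∀ {a b} → a < b → (a <ᵇ b) ≡ true
<⇒<ᵇ≡true a<b = Equivalence.to T-≡ (<⇒<ᵇ a<b)

≥⇒<ᵇ≡false : ∀ {a b} → b ≤ a → (a <ᵇ b) ≡ false
≥⇒<ᵇ≡false z≤n = refl
≥⇒<ᵇ≡false (s≤s b≤a) = ≥⇒<ᵇ≡false b≤a

<ᵇ-irrefl : ∀ m → ¬ T (m <ᵇ m)
<ᵇ-irrefl m m<m = n≮n m (<ᵇ⇒< m m m<m)

+-<ᵇ-cancelˡ : ∀ m a b → (m + a <ᵇ m + b) ≡ (a <ᵇ b)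
+-<ᵇ-cancelˡ zero a b = refl
+-<ᵇ-cancelˡ (suc m) a b = +-<ᵇ-cancelˡ m a b

<ᵇ-preserved : ∀ {a b c d} → (a < b → c < d) → (b ≤ a → d ≤ c) → (a <ᵇ b) ≡ (c <ᵇ d)
<ᵇ-preserved {a} {b} <-pres ≥-pres with a <? b
... | yes a<b = trans (<⇒<ᵇ≡true a<b) (sym (<⇒<ᵇ≡true (<-pres a<b)))
... | no a≮b = trans (≥⇒<ᵇ≡false (≮⇒≥ a≮b)) (sym (≥⇒<ᵇ≡false (≥-pres (≮⇒≥ a≮b))))

descentsBy-map : ∀ {A B : Set} (key : B → ℕ) (f : A → B) (xs : List A) →
  descentsBy key (List.map f xs) ≡ descentsBy (key ∘ f) xs
descentsBy-map key f [] = refl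
descentsBy-map key f (x ∷ []) = refl
descentsBy-map key f (x ∷ y ∷ xs) =
  cong (bit (key (f y) <ᵇ key (f x)) +_) (descentsBy-map key f (y ∷ xs))

descentsBy-toList-map : ∀ {A B : Set} {k} (key : B → ℕ) (f : A → B) (v : Vec A k) →
  descentsBy key (toList (Vec.map f v)) ≡ descentsBy (key ∘ f) (toList v)
descentsBy-toList-map key f v = trans (cong (descentsBy key) (toList-map f v)) (descentsBy-map key f (toList v))

descentsBy-cong : ∀ {A : Set} (key₁ key₂ : A → ℕ) →
  (∀ x y → (key₁ y <ᵇ key₁ x) ≡ (key₂ y <ᵇ key₂ x)) →
  ∀ xs → descentsBy key₁ xs ≡ descentsBy key₂ xs
descentsBy-cong key₁ key₂ same [] = refl
descentsBy-cong key₁ key₂ same (x ∷ []) = refl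
descentsBy-cong key₁ key₂ same (x ∷ y ∷ xs) =
  cong₂ (λ b d → bit b + d) (same x y) (descentsBy-cong key₁ key₂ same (y ∷ xs))

countᵇ : ∀ {A : Set} → (A → Bool) → List A → ℕ
countᵇ p xs = length (filterᵇ p xs)

module _ {A : Set} where

  countᵇ-↭ : ∀ (p : A → Bool) {xs ys} → xs ↭ ys → countᵇ p xs ≡ countᵇ p ys
  countᵇ-↭ p xs↭ys = ↭-length (filter-↭ (T? ∘ p) xs↭ys)

  countᵇ-cong : ∀ {p q : A → Bool} → (∀ x → p x ≡ q x) → ∀ xs → countᵇ p xs ≡ countᵇ q xs
  countᵇ-cong {p} {q} p≗q xs =
    cong length (filter-≐ (T? ∘ p) (T? ∘ q) (subst T (p≗q _) , subst T (sym (p≗q _))) xs)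

  countᵇ-map : ∀ {B : Set} (p : B → Bool) (f : A → B) xs → countᵇ p (List.map f xs) ≡ countᵇ (p ∘ f) xs
  countᵇ-map p f [] = refl
  countᵇ-map p f (x ∷ xs) with p (f x)
  ... | true = cong suc (countᵇ-map p f xs)
  ... | false = countᵇ-map p f xs

  countᵇ-++ : ∀ (p : A → Bool) xs ys → countᵇ p (xs ++ ys) ≡ countᵇ p xs + countᵇ p ys
  countᵇ-++ p xs ys = trans (cong length (filter-++ (T? ∘ p) xs ys)) (length-++ (filterᵇ p xs))

  countᵇ<length : ∀ (p : A → Bool) {x xs} → x ∈ xs → ¬ T (p x) → countᵇ p xs < length xs
  countᵇ<length p {xs = xs} x∈xs ¬px = filter-notAll (T? ∘ p) xs (Any.map (λ { refl → ¬px }) x∈xs)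

  countᵇ-mono : ∀ {p q : A → Bool} → (∀ x → T (p x) → T (q x)) → ∀ xs → countᵇ p xs ≤ countᵇ q xs
  countᵇ-mono p⇒q [] = z≤n
  countᵇ-mono {p} {q} p⇒q (x ∷ xs) with p x | q x | p⇒q x
  ... | true | true | _ = s≤s (countᵇ-mono p⇒q xs)
  ... | true | false | px⇒qx = ⊥-elim (px⇒qx tt)
  ... | false | true | _ = m≤n⇒m≤1+n (countᵇ-mono p⇒q xs)
  ... | false | false | _ = countᵇ-mono p⇒q xs

  countᵇ-mono-< : ∀ {p q : A → Bool} → (∀ x → T (p x) → T (q x)) →
    ∀ {x xs} → x ∈ xs → ¬ T (p x) → T (q x) → countᵇ p xs < countᵇ q xs
  countᵇ-mono-< {p} {q} p⇒q {xs = x ∷ xs} (here refl) ¬px qx with p x | q x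
  ... | true | _ = ⊥-elim (¬px tt)
  ... | false | true = s≤s (countᵇ-mono p⇒q xs)
  ... | false | false = ⊥-elim qx
  countᵇ-mono-< {p} {q} p⇒q {xs = y ∷ xs} (there x∈xs) ¬px qx with p y | q y | p⇒q y
  ... | true | true | _ = s≤s (countᵇ-mono-< p⇒q x∈xs ¬px qx)
  ... | true | false | py⇒qy = ⊥-elim (py⇒qy tt)
  ... | false | true | _ = m<n⇒m<1+n (countᵇ-mono-< p⇒q x∈xs ¬px qx)
  ... | false | false | _ = countᵇ-mono-< p⇒q x∈xs ¬px qx

module _ {A B C : Set} (f : A → B → C) where

  concatMap-map≡cartesianProductWith : ∀ xs ys →
    concatMap (λ x → List.map (f x) ys) xs ≡ cartesianProductWith f xs ys
  concatMap-map≡cartesianProductWith [] ys = refl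
  concatMap-map≡cartesianProductWith (x ∷ xs) ys =
    cong (List.map (f x) ys ++_) (concatMap-map≡cartesianProductWith xs ys)

  length-cartesianProductWith : ∀ xs ys → length (cartesianProductWith f xs ys) ≡ length xs * length ys
  length-cartesianProductWith [] ys = refl
  length-cartesianProductWith (x ∷ xs) ys = trans (length-++ (List.map (f x) ys))
    (cong₂ _+_ (length-map (f x) ys) (length-cartesianProductWith xs ys))

  countᵇ-cartesianProductWith : ∀ (p : C → Bool) {ys c} → (∀ x → countᵇ p (List.map (f x) ys) ≡ c) →
    ∀ xs → countᵇ p (cartesianProductWith f xs ys) ≡ length xs * c
  countᵇ-cartesianProductWith p rows [] = refl
  countᵇ-cartesianProductWith p {ys} rows (x ∷ xs) = trans (countᵇ-++ p (List.map (f x) ys) _)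
    (cong₂ _+_ (rows x) (countᵇ-cartesianProductWith p rows xs))

  unique-cartesianProductWith : ∀ {xs ys} → Unique xs → Unique ys →
    (∀ a → Injective _≡_ _≡_ (f a)) →
    (∀ {a a′ b b′} → b ∈ ys → b′ ∈ ys → f a b ≡ f a′ b′ → a ≡ a′) →
    Unique (cartesianProductWith f xs ys)
  unique-cartesianProductWith [] ys! rows-injective separates = []
  unique-cartesianProductWith {x ∷ xs} {ys} (x∉xs ∷ xs!) ys! rows-injective separates =
    Unique.++⁺ (Unique.map⁺ (rows-injective x) ys!)
      (unique-cartesianProductWith xs! ys! rows-injective separates) row#rest
    where
    row#rest : Disjoint (List.map (f x) ys) (cartesianProductWith f xs ys)
    row#rest (c∈row , c∈rest) with ∈-map⁻ (f x) c∈row | ∈-cartesianProductWith⁻ f xs ys c∈rest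
    ... | b , b∈ys , refl | a , b′ , a∈xs , b′∈ys , e = All.lookup x∉xs a∈xs (separates b∈ys b′∈ys e)

unique∧set⇒↭ : ∀ {A : Set} {xs ys : List A} → Unique xs → Unique ys → xs ∼[ set ] ys → xs ↭ ys
unique∧set⇒↭ xs! ys! xs≈ys = ∼bag⇒↭ (unique∧set⇒bag xs! ys! xs≈ys)

module _ {A : Set} (xs : List A) where

  allVecs-suc : ∀ k → allVecs xs (suc k) ≡ cartesianProductWith _∷_ xs (allVecs xs k)
  allVecs-suc k = concatMap-map≡cartesianProductWith _∷_ xs (allVecs xs k)

  ∈-allVecs : (∀ x → x ∈ xs) → ∀ {k} (v : Vec A k) → v ∈ allVecs xs k
  ∈-allVecs all∈ [] = here refl
  ∈-allVecs all∈ {suc k} (x ∷ v) =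
    subst (x ∷ v ∈_) (sym (allVecs-suc k)) (∈-cartesianProductWith⁺ _∷_ (all∈ x) (∈-allVecs all∈ v))

  allVecs-unique : Unique xs → ∀ k → Unique (allVecs xs k)
  allVecs-unique xs! zero = All.[] ∷ []
  allVecs-unique xs! (suc k) = subst Unique (sym (allVecs-suc k))
    (Unique.cartesianProductWith⁺ _∷_ ∷-injective xs! (allVecs-unique xs! k))

  length-allVecs : ∀ k → length (allVecs xs k) ≡ length xs ^ k
  length-allVecs zero = refl
  length-allVecs (suc k) = begin
    length (allVecs xs (suc k))                          ≡⟨ cong length (allVecs-suc k) ⟩
    length (cartesianProductWith _∷_ xs (allVecs xs k))  ≡⟨ length-cartesianProductWith _∷_ xs _ ⟩
    length xs * length (allVecs xs k)                    ≡⟨ cong (length xs *_) (length-allVecs k) ⟩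
    length xs ^ suc k                                    ∎

bools : List Bool
bools = true ∷ false ∷ []

∈-bools : ∀ b → b ∈ bools
∈-bools true = here refl
∈-bools false = there (here refl)

bools-unique : Unique bools
bools-unique = ((λ ()) All.∷ All.[]) ∷ (All.[] ∷ [])

Fin-injective⇒surjective : ∀ {n} (f : Fin n → Fin n) → Injective _≡_ _≡_ f → ∀ y → ∃ λ x → f x ≡ y
Fin-injective⇒surjective {suc m} f f-injective y with any? (λ x → f x ≟ y)
... | yes hit = hit
... | no miss = contradiction (injective⇒≤ g-injective) (n≮n m)
  where
  y≢f : ∀ x → y ≢ f x
  y≢f x y≡fx = miss (x , sym y≡fx)
  g : Fin (suc m) → Fin m
  g x = punchOut (y≢f x)
  g-injective : Injective _≡_ _≡_ g
  g-injective e = f-injective (punchOut-injective (y≢f _) (y≢f _) e)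

module FinInverse {n : ℕ} (f : Fin n → Fin n) (f-injective : Injective _≡_ _≡_ f) where

  f⁻¹ : Fin n → Fin n
  f⁻¹ y = proj₁ (Fin-injective⇒surjective f f-injective y)

  f∘f⁻¹ : ∀ y → f (f⁻¹ y) ≡ y
  f∘f⁻¹ y = proj₂ (Fin-injective⇒surjective f f-injective y)

  f⁻¹∘f : ∀ x → f⁻¹ (f x) ≡ x
  f⁻¹∘f x = f-injective (f∘f⁻¹ (f x))

  f⁻¹-injective : Injective _≡_ _≡_ f⁻¹
  f⁻¹-injective {x} {y} e = trans (sym (f∘f⁻¹ x)) (trans (cong f e) (f∘f⁻¹ y))

Vec-map-injective : ∀ {A B : Set} {k} {f : A → B} →
  Injective _≡_ _≡_ f → Injective _≡_ _≡_ (Vec.map {n = k} f)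
Vec-map-injective f-injective {[]} {[]} _ = refl
Vec-map-injective f-injective {x ∷ u} {y ∷ v} e =
  cong₂ _∷_ (f-injective (∷-injectiveˡ e)) (Vec-map-injective f-injective (∷-injectiveʳ e))

unique-toList-map : ∀ {A B : Set} {k} {f : A → B} → Injective _≡_ _≡_ f →
  ∀ {v : Vec A k} → Unique (toList v) → Unique (toList (Vec.map f v))
unique-toList-map {f = f} f-injective {v} v! = subst Unique (sym (toList-map f v)) (Unique.map⁺ f-injective v!)

unique⇒lookup-injective : ∀ {A : Set} {k} {v : Vec A k} → Unique (toList v) → Injective _≡_ _≡_ (lookup v)
unique⇒lookup-injective v! = VecUnique.lookup-injective (toVecUnique v!) _ _
  where
  toVecUnique : ∀ {A : Set} {k} {v : Vec A k} → Unique (toList v) → VecUnique.Unique v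
  toVecUnique {v = []} [] = []
  toVecUnique {v = x ∷ v} (x∉v ∷ v!) = VecAll.toList⁻ x∉v ∷ toVecUnique v!

module _ {n : ℕ} where
  open DecUnique (_≟_ {n}) using (unique?)

  ∈-Sn⁺ : ∀ {σ : Vec (Fin n) n} → Unique (toList σ) → σ ∈ Sn n
  ∈-Sn⁺ {σ} σ! = ∈-filter⁺ (unique? ∘ toList) (∈-allVecs (allFin n) ∈-allFin σ) σ!

  ∈-Sn⁻ : ∀ {σ : Vec (Fin n) n} → σ ∈ Sn n → Unique (toList σ)
  ∈-Sn⁻ σ∈Sn = proj₂ (∈-filter⁻ (unique? ∘ toList) {xs = allVecs (allFin n) n} σ∈Sn)

  Sn-unique : Unique (Sn n)
  Sn-unique = Unique.filter⁺ (unique? ∘ toList) (allVecs-unique (allFin n) (Unique.allFin⁺ n) n)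

  map-Sn↭Sn : ∀ {β : Fin n → Fin n} → Injective _≡_ _≡_ β → List.map (Vec.map β) (Sn n) ↭ Sn n
  map-Sn↭Sn {β} β-injective =
    unique∧set⇒↭ (Unique.map⁺ (Vec-map-injective β-injective) Sn-unique) Sn-unique (mk⇔ to from)
    where
    open FinInverse β β-injective
      renaming (f⁻¹ to β⁻¹; f∘f⁻¹ to β∘β⁻¹; f⁻¹-injective to β⁻¹-injective)

    to : ∀ {σ} → σ ∈ List.map (Vec.map β) (Sn n) → σ ∈ Sn n
    to σ∈ with ∈-map⁻ (Vec.map β) σ∈
    ... | τ , τ∈Sn , refl = ∈-Sn⁺ (unique-toList-map β-injective (∈-Sn⁻ τ∈Sn))

    from : ∀ {σ} → σ ∈ Sn n → σ ∈ List.map (Vec.map β) (Sn n)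
    from {σ} σ∈Sn = subst (_∈ List.map (Vec.map β) (Sn n)) β∘β⁻¹∘σ≡σ
      (∈-map⁺ (Vec.map β) (∈-Sn⁺ (unique-toList-map β⁻¹-injective (∈-Sn⁻ σ∈Sn))))
      where
      β∘β⁻¹∘σ≡σ : Vec.map β (Vec.map β⁻¹ σ) ≡ σ
      β∘β⁻¹∘σ≡σ = trans (sym (map-∘ β β⁻¹ σ)) (trans (map-cong β∘β⁻¹ σ) (map-id σ))

module Standardisation {n : ℕ} (key : Fin n → ℕ) (key-injective : Injective _≡_ _≡_ key) where

  below : Fin n → ℕ
  below x = countᵇ (λ z → key z <ᵇ key x) (allFin n)

  below<n : ∀ x → below x < n
  below<n x = subst (below x <_) (length-tabulate (λ i → i))
    (countᵇ<length (λ z → key z <ᵇ key x) (∈-allFin x) (<ᵇ-irrefl (key x)))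

  below-mono-≤ : ∀ {x y} → key y ≤ key x → below y ≤ below x
  below-mono-≤ ky≤kx = countᵇ-mono (λ z kz<ky → <⇒<ᵇ (<-≤-trans (<ᵇ⇒< _ _ kz<ky) ky≤kx)) (allFin n)

  below-mono-< : ∀ {x y} → key y < key x → below y < below x
  below-mono-< {x} {y} ky<kx = countᵇ-mono-< (λ z kz<ky → <⇒<ᵇ (<-trans (<ᵇ⇒< _ _ kz<ky) ky<kx))
    (∈-allFin y) (<ᵇ-irrefl (key y)) (<⇒<ᵇ ky<kx)

  below-injective : Injective _≡_ _≡_ below
  below-injective {x} {y} bx≡by with <-cmp (key x) (key y)
  ... | tri< kx<ky _ _ = contradiction bx≡by (<⇒≢ (below-mono-< kx<ky))
  ... | tri≈ _ kx≡ky _ = key-injective kx≡ky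
  ... | tri> _ _ ky<kx = contradiction (sym bx≡by) (<⇒≢ (below-mono-< ky<kx))

  st : Fin n → Fin n
  st x = fromℕ< (below<n x)

  toℕ-st : ∀ x → toℕ (st x) ≡ below x
  toℕ-st x = toℕ-fromℕ< (below<n x)

  st-injective : Injective _≡_ _≡_ st
  st-injective {x} {y} stx≡sty = below-injective (begin
    below x      ≡⟨ sym (toℕ-st x) ⟩
    toℕ (st x)   ≡⟨ cong toℕ stx≡sty ⟩
    toℕ (st y)   ≡⟨ toℕ-st y ⟩
    below y      ∎)

  st-<ᵇ : ∀ x y → (key y <ᵇ key x) ≡ (toℕ (st y) <ᵇ toℕ (st x))
  st-<ᵇ x y = trans (<ᵇ-preserved below-mono-< below-mono-≤) (sym (cong₂ _<ᵇ_ (toℕ-st y) (toℕ-st x)))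

-- An order embedding of -n < … < -1 < 1 < … < n into ℕ.
value : ∀ {n} → Signed n → ℕ
value {n} (true , i) = n + toℕ i
value {n} (false , i) = n ∸ suc (toℕ i)

desℤ : ∀ {n k} → Vec (Signed n) k → ℕ
desℤ w = descentsBy value (toList w)

module _ {n : ℕ} where

  rank-negative : ∀ (i : Fin n) → rank (false , i) ≡ n + value (false , i)
  rank-negative i = +-∸-assoc n (toℕ<n i)

  value-negative<n : ∀ (i : Fin n) → value (false , i) < n
  value-negative<n i = ∸-monoʳ-< z<s (toℕ<n i)

  value-negative<positive : ∀ (i j : Fin n) → value (false , i) < value (true , j)
  value-negative<positive i j = <-≤-trans (value-negative<n i) (m≤m+n n (toℕ j))

  rank-positive<negative : ∀ (i j : Fin n) → rank (true , i) < rank (false , j)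
  rank-positive<negative i j =
    subst (toℕ i <_) (sym (rank-negative j)) (<-≤-trans (toℕ<n i) (m≤m+n n _))

  value-injective : Injective _≡_ _≡_ (value {n})
  value-injective {true , i} {true , j} e = cong (true ,_) (toℕ-injective (+-cancelˡ-≡ n _ _ e))
  value-injective {false , i} {false , j} e =
    cong (false ,_) (toℕ-injective (suc-injective (∸-cancelˡ-≡ (toℕ<n i) (toℕ<n j) e)))
  value-injective {true , i} {false , j} e = contradiction (sym e) (<⇒≢ (value-negative<positive j i))
  value-injective {false , i} {true , j} e = contradiction e (<⇒≢ (value-negative<positive i j))

  descent-shift : ∀ {k l} (x y : Signed n) (u : Vec (Signed n) k) (v : Vec (Signed n) l) →
    firstPos (x ∷ u) + bit (rank y <ᵇ rank x) ≡ bit (value y <ᵇ value x) + firstPos (y ∷ v)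
  descent-shift (true , i) (true , j) u v =
    trans (+-comm 1 _) (cong (λ b → bit b + 1) (sym (+-<ᵇ-cancelˡ n (toℕ j) (toℕ i))))
  descent-shift (false , i) (false , j) u v
    rewrite rank-negative i | rank-negative j =
    trans (cong bit (+-<ᵇ-cancelˡ n _ _)) (sym (+-identityʳ _))
  descent-shift (true , i) (false , j) u v
    rewrite ≥⇒<ᵇ≡false (<⇒≤ (rank-positive<negative i j))
          | <⇒<ᵇ≡true (value-negative<positive j i) = refl
  descent-shift (false , i) (true , j) u v
    rewrite <⇒<ᵇ≡true (rank-positive<negative j i)
          | ≥⇒<ᵇ≡false (<⇒≤ (value-negative<positive i j)) = refl

  -- Not a definitional equation: lastNeg inspects the sign of the head first.
  lastNeg-∷ : ∀ {k} (x y : Signed n) (v : Vec (Signed n) k) → lastNeg (x ∷ y ∷ v) ≡ lastNeg (y ∷ v)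
  lastNeg-∷ (true , _) y v = refl
  lastNeg-∷ (false , _) y v = refl

  telescope : ∀ {k} (x : Signed n) (v : Vec (Signed n) k) →
    firstPos (x ∷ v) + descentsBy rank (toList (x ∷ v)) + lastNeg (x ∷ v) ≡ suc (desℤ (x ∷ v))
  telescope (true , i) [] = refl
  telescope (false , i) [] = refl
  telescope x (y ∷ v) = begin
    F + (b + D) + lastNeg (x ∷ y ∷ v)  ≡⟨ cong (F + (b + D) +_) (lastNeg-∷ x y v) ⟩
    F + (b + D) + L                    ≡⟨ cong (_+ L) (sym (+-assoc F b D)) ⟩
    F + b + D + L                      ≡⟨ cong (λ m → m + D + L) (descent-shift x y (y ∷ v) v) ⟩
    b′ + F′ + D + L                    ≡⟨ cong (_+ L) (+-assoc b′ F′ D) ⟩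
    b′ + (F′ + D) + L                  ≡⟨ +-assoc b′ (F′ + D) L ⟩
    b′ + (F′ + D + L)                  ≡⟨ cong (b′ +_) (telescope y v) ⟩
    b′ + suc (desℤ (y ∷ v))            ≡⟨ +-suc b′ _ ⟩
    suc (desℤ (x ∷ y ∷ v))             ∎
    where
    F F′ b b′ D L : ℕ
    F = firstPos (x ∷ y ∷ v)
    F′ = firstPos (y ∷ v)
    b = bit (rank y <ᵇ rank x)
    b′ = bit (value y <ᵇ value x)
    D = descentsBy rank (toList (y ∷ v))
    L = lastNeg (y ∷ v)

cd≡suc-desℤ : ∀ {n} (w : Vec (Signed n) n) → 1 ≤ n → cd w ≡ suc (desℤ w)
cd≡suc-desℤ (x ∷ v) (s≤s z≤n) = begin
  D + L + F           ≡⟨ +-comm (D + L) F ⟩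
  F + (D + L)         ≡⟨ sym (+-assoc F D L) ⟩
  F + D + L           ≡⟨ telescope x v ⟩
  suc (desℤ (x ∷ v))  ∎
  where
  F D L : ℕ
  F = firstPos (x ∷ v)
  D = descentsBy rank (toList (x ∷ v))
  L = lastNeg (x ∷ v)

zipV-injective : ∀ {A B : Set} {k} {s s′ : Vec A k} {σ σ′ : Vec B k} →
  zipV s σ ≡ zipV s′ σ′ → s ≡ s′ × σ ≡ σ′
zipV-injective {s = []} {[]} {[]} {[]} _ = refl , refl
zipV-injective {s = _ ∷ _} {_ ∷ _} {_ ∷ _} {_ ∷ _} e with ∷-injective e
... | refl , tails with zipV-injective tails
...   | refl , refl = refl , refl

signed : ∀ {n k} → Vec Bool n → Vec (Fin n) k → Vec (Signed n) k
signed t σ = Vec.map (λ x → (lookup t x , x)) σ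

signed≡zipV : ∀ {n k} (t : Vec Bool n) (σ : Vec (Fin n) k) → signed t σ ≡ zipV (Vec.map (lookup t) σ) σ
signed≡zipV t [] = refl
signed≡zipV t (x ∷ σ) = cong ((lookup t x , x) ∷_) (signed≡zipV t σ)

signed-injective : ∀ {n k} {t t′ : Vec Bool n} {σ σ′ : Vec (Fin n) k} → signed t σ ≡ signed t′ σ′ →
  Vec.map (lookup t) σ ≡ Vec.map (lookup t′) σ′ × σ ≡ σ′
signed-injective {t = t} {t′} {σ} {σ′} e =
  zipV-injective (trans (sym (signed≡zipV t σ)) (trans e (signed≡zipV t′ σ′)))

module SignsByValue {n : ℕ} {σ : Vec (Fin n) n} (σ! : Unique (toList σ)) where
  open FinInverse (lookup σ) (unique⇒lookup-injective σ!)
    renaming (f⁻¹ to σ⁻¹; f∘f⁻¹ to σ∘σ⁻¹; f⁻¹∘f to σ⁻¹∘σ)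

  byValue : ∀ {A : Set} → Vec A n → Vec A n
  byValue s = tabulate (lookup s ∘ σ⁻¹)

  map-lookup-byValue : ∀ {A : Set} (s : Vec A n) → Vec.map (lookup (byValue s)) σ ≡ s
  map-lookup-byValue s = begin
    Vec.map (lookup (byValue s)) σ                      ≡⟨ sym (tabulate∘lookup _) ⟩
    tabulate (lookup (Vec.map (lookup (byValue s)) σ))  ≡⟨ tabulate-cong lookup≗ ⟩
    tabulate (lookup s)                                 ≡⟨ tabulate∘lookup s ⟩
    s                                                   ∎
    where
    lookup≗ : ∀ i → lookup (Vec.map (lookup (byValue s)) σ) i ≡ lookup s i
    lookup≗ i = begin
      lookup (Vec.map (lookup (byValue s)) σ) i ≡⟨ lookup-map i _ σ ⟩
      lookup (byValue s) (lookup σ i)           ≡⟨ lookup∘tabulate _ (lookup σ i) ⟩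
      lookup s (σ⁻¹ (lookup σ i))               ≡⟨ cong (lookup s) (σ⁻¹∘σ i) ⟩
      lookup s i                                ∎

  byValue-map-lookup : ∀ {A : Set} (t : Vec A n) → byValue (Vec.map (lookup t) σ) ≡ t
  byValue-map-lookup t = trans (tabulate-cong lookup≗) (tabulate∘lookup t)
    where
    lookup≗ : ∀ x → lookup (Vec.map (lookup t) σ) (σ⁻¹ x) ≡ lookup t x
    lookup≗ x = trans (lookup-map (σ⁻¹ x) (lookup t) σ) (cong (lookup t) (σ∘σ⁻¹ x))

module _ (n : ℕ) where

  Cn≡cartesianProductWith : Cn n ≡ cartesianProductWith zipV (allVecs bools n) (Sn n)
  Cn≡cartesianProductWith = concatMap-map≡cartesianProductWith zipV (allVecs bools n) (Sn n)

  signedSn : List (Vec (Signed n) n)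
  signedSn = cartesianProductWith signed (allVecs bools n) (Sn n)

  Cn-unique : Unique (Cn n)
  Cn-unique = subst Unique (sym Cn≡cartesianProductWith)
    (Unique.cartesianProductWith⁺ zipV zipV-injective (allVecs-unique bools bools-unique n) Sn-unique)

  -- signed t σ forgets the signs of values missing from σ, so (t , σ) is recovered only for σ ∈ S_n.
  signedSn-unique : Unique signedSn
  signedSn-unique = unique-cartesianProductWith signed (allVecs-unique bools bools-unique n) Sn-unique
    (λ t → proj₂ ∘ signed-injective {t = t} {t}) separates
    where
    separates : ∀ {t t′ σ σ′} → σ ∈ Sn n → σ′ ∈ Sn n → signed t σ ≡ signed t′ σ′ → t ≡ t′
    separates {t} {t′} {σ} σ∈Sn _ e with signed-injective {t = t} {t′} e
    ... | signs≡ , refl = begin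
      t                                ≡⟨ sym (byValue-map-lookup t) ⟩
      byValue (Vec.map (lookup t) σ)   ≡⟨ cong byValue signs≡ ⟩
      byValue (Vec.map (lookup t′) σ)  ≡⟨ byValue-map-lookup t′ ⟩
      t′                               ∎
      where open SignsByValue (∈-Sn⁻ σ∈Sn)

  Cn↭signedSn : Cn n ↭ signedSn
  Cn↭signedSn = unique∧set⇒↭ Cn-unique signedSn-unique (mk⇔ to from)
    where
    to : ∀ {w} → w ∈ Cn n → w ∈ signedSn
    to w∈Cn with ∈-cartesianProductWith⁻ zipV (allVecs bools n) (Sn n)
                   (subst (_ ∈_) Cn≡cartesianProductWith w∈Cn)
    ... | s , σ , _ , σ∈Sn , refl = subst (_∈ signedSn) signed≡
      (∈-cartesianProductWith⁺ signed (∈-allVecs bools ∈-bools (byValue s)) σ∈Sn)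
      where
      open SignsByValue (∈-Sn⁻ σ∈Sn)
      signed≡ : signed (byValue s) σ ≡ zipV s σ
      signed≡ = trans (signed≡zipV (byValue s) σ) (cong (λ s′ → zipV s′ σ) (map-lookup-byValue s))

    from : ∀ {w} → w ∈ signedSn → w ∈ Cn n
    from w∈ with ∈-cartesianProductWith⁻ signed (allVecs bools n) (Sn n) w∈
    ... | t , σ , _ , σ∈Sn , refl = subst (_∈ Cn n) (sym (signed≡zipV t σ))
      (subst (zipV (Vec.map (lookup t) σ) σ ∈_) (sym Cn≡cartesianProductWith)
        (∈-cartesianProductWith⁺ zipV (∈-allVecs bools ∈-bools (Vec.map (lookup t) σ)) σ∈Sn))

module _ {n : ℕ} (t : Vec Bool n) where

  private
    key : Fin n → ℕ
    key x = value (lookup t x , x)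

    key-injective : Injective _≡_ _≡_ key
    key-injective {x} {y} e = cong proj₂ (value-injective {x = lookup t x , x} {y = lookup t y , y} e)

  open Standardisation key key-injective

  desℤ-signed : ∀ (σ : Vec (Fin n) n) → desℤ (signed t σ) ≡ des (Vec.map st σ)
  desℤ-signed σ = begin
    desℤ (signed t σ)                 ≡⟨ descentsBy-toList-map value _ σ ⟩
    descentsBy key (toList σ)         ≡⟨ descentsBy-cong key (toℕ ∘ st) st-<ᵇ (toList σ) ⟩
    descentsBy (toℕ ∘ st) (toList σ)  ≡⟨ sym (descentsBy-toList-map toℕ st σ) ⟩
    des (Vec.map st σ)                ∎

  countᵇ-desℤ-signed : ∀ r → countᵇ (λ w → desℤ w ≡ᵇ r) (List.map (signed t) (Sn n)) ≡ A n r
  countᵇ-desℤ-signed r = begin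
    countᵇ (λ w → desℤ w ≡ᵇ r) (List.map (signed t) (Sn n))
      ≡⟨ countᵇ-map _ (signed t) (Sn n) ⟩
    countᵇ (λ σ → desℤ (signed t σ) ≡ᵇ r) (Sn n)
      ≡⟨ countᵇ-cong (λ σ → cong (_≡ᵇ r) (desℤ-signed σ)) (Sn n) ⟩
    countᵇ (λ σ → des (Vec.map st σ) ≡ᵇ r) (Sn n)
      ≡⟨ sym (countᵇ-map _ (Vec.map st) (Sn n)) ⟩
    countᵇ (λ σ → des σ ≡ᵇ r) (List.map (Vec.map st) (Sn n))
      ≡⟨ countᵇ-↭ _ (map-Sn↭Sn st-injective) ⟩
    A n r
      ∎

lemma5 : (n : ℕ) → 1 ≤ n → (r : ℕ) → N n (suc r) ≡ 2 ^ n * A n r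
lemma5 n 1≤n r = begin
  N n (suc r)
    ≡⟨ countᵇ-cong (λ w → cong (_≡ᵇ suc r) (cd≡suc-desℤ w 1≤n)) (Cn n) ⟩
  countᵇ (λ w → desℤ w ≡ᵇ r) (Cn n)
    ≡⟨ countᵇ-↭ _ (Cn↭signedSn n) ⟩
  countᵇ (λ w → desℤ w ≡ᵇ r) (signedSn n)
    ≡⟨ countᵇ-cartesianProductWith signed _ (λ t → countᵇ-desℤ-signed t r) (allVecs bools n) ⟩
  length (allVecs bools n) * A n r
    ≡⟨ cong (_* A n r) (length-allVecs bools n) ⟩
  2 ^ n * A n r
    ∎
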